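{- Let $M=\langle W,\{\sim_i,\mathscr{A}_i\}_{i\in\mathcal{G}},V\rangle$ be an epistemic model with awareness such that $\mathscr{A}_i(w)=\mathscr{A}_i(v)$ for every $i\in\mathcal{G}$ and all $w,v\in W$. Let $t^{M\to}(M)$ be its HMS-transform and let $w\in W$. Then for every $\varphi\in\mathcal{L}^*_{AIL}(\mathcal{P},\mathcal{G})$ that satisfies the A-condition at $w$: $$M,w\vDash_{AIL^*}\varphi\iff t^{M\to}(M),[w]_{At(\varphi)}\vDash_{HMS}t(\varphi).$$
   Context: $\mathcal{P}$ is a countable set of atomic propositions and $\mathcal{G}$ a finite set of agents. Languages. - $\mathcal{L}_{PL}(\mathcal{P})$ is the set of propositional formulae $\varphi::=p\mid\neg\varphi\mid\varphi\wedge\varphi$ with $p\in\mathcal{P}$. - $At(\varphi)$ denotes the set of atoms occurring in $\varphi$. - $\mathcal{L}^*_{AIL}(\mathcal{P},\mathcal{G})$ consists of the formulae $\varphi$, $A_i\varphi$ and $[\approx]_iI_i[\approx]_i\varphi$, with $\varphi\in\mathcal{L}_{PL}(\mathcal{P})$ and $i\in\mathcal{G}$. - $\mathcal{L}^*_{HMS}(\mathcal{P},\mathcal{G})$ consists of the formulae $\varphi$, $A_i\varphi$ and $I_i\varphi$, with $\varphi\in\mathcal{L}_{PL}(\mathcal{P})$ and $i\in\mathcal{G}$. - $At(A_i\varphi)=At(I_i\varphi)=At([\approx]_iI_i[\approx]_i\varphi)=At(\varphi)$. Translation. $t:\mathcal{L}^*_{AIL}\to\mathcal{L}^*_{HMS}$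 is given by: - $t(p)=p$, $t(\neg\varphi)=\neg t(\varphi)$ and $t(\varphi\wedge\psi)=t(\varphi)\wedge t(\psi)$; - $t(A_i\varphi)=A_i t(\varphi)$; - $t([\approx]_iI_i[\approx]_i\varphi)=I_i t(\varphi)$. A-condition. A formula $\varphi\in\mathcal{L}^*_{AIL}$ satisfies the A-condition at $w$ iff, whenever $\varphi$ is of the form $A_i\psi$ or $[\approx]_iI_i[\approx]_i\psi$, we have $At(\psi)=\mathscr{A}_i(w)$. AIL models. An epistemic model with awareness is $M=\langle W,\{\sim_i,\mathscr{A}_i\}_{i\in\mathcal{G}},V\rangle$, where: - $W$ is a nonempty set; - each $\sim_i$ is an equivalence relation on $W$; - $\mathscr{A}_i:W\to2^{\mathcal{P}}$ satisfies $\mathscr{A}_i(w)=\mathscr{A}_i(v)$ whenever $w\sim_i v$; - $V:\mathcal{P}\to2^W$ is a valuation. The A-equivalence relation $\approx_i$ is defined by: $w\approx_i v$ iff $\mathscr{A}_i(w)=\mathscr{A}_i(v)$ and, for every $p\in\mathscr{A}_i(w)$, $w\in V(p)\Leftrightarrow v\in V(p)$. AIL satisfaction $\vDash_{AIL^*}$: - Atoms, $\neg$ and $\wedge$ are interpreted classically via $V$. - $M,w\vDash A_i\varphi$ iff $At(\varphi)\subseteq\mathscr{A}_i(w)$. - $M,w\vDash[\approx]_iI_i[\approx]_i\varphi$ iff $M,v\vDash\varphi$ for all $v$ with $w\approx_i u\sim_i u'\approx_i v$ for some $u,u'\in W$. HMS-transform. For $\Phi\subseteq\mathcal{P}$, let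 $w\approx_\Phi v$ iff, for every $p\in\Phi$, $w\in V(p)\Leftrightarrow v\in V(p)$. - $W_\Phi:=W/\approx_\Phi$. The spaces $W_\Phi$ for different $\Phi$ are regarded as pairwise disjoint, with each class tagged by its index $\Phi$. - $[w]_\Phi$ is the class of $w$ in $W_\Phi$, and $W^*:=\bigcup_{\Phi\subseteq\mathcal{P}}W_\Phi$. - For $\Psi\subseteq\Phi$, $m^\Phi_\Psi([w]_\Phi)=[w]_\Psi$. - $\Lambda^*_i:W^*\to2^{W^*}\setminus\{\emptyset\}$ is defined as follows. For $\Phi=\mathcal{P}$: $[v]_{\mathcal{P}}\in\Lambda^*_i([w]_{\mathcal{P}})$ iff $w'\sim_i v'$ for some $w'\in[w]_{\mathcal{P}}$ and $v'\in[v]_{\mathcal{P}}$. Otherwise: $\Lambda^*_i([w]_\Phi)=\{m^{\mathcal{P}}_\Phi(w^*)\mid w^*\in\Lambda^*_i([w]_{\mathcal{P}})\}$. - $\alpha^*_i([w]_\Upsilon)=W_{\mathscr{A}_i(w)\cap\Upsilon}$. - $v^*(p)=\bigcup_{\{p\}\subseteq\Phi\subseteq\mathcal{P}}\{[w]_\Phi\mid w\in V(p)\}$. - Write $W_\Psi\le W_\Phi$ iff $\Psi\subseteq\Phi$. HMS satisfaction. Let $\|\varphi\|:=\{w^*\in W^*\mid t^{M\to}(M),w^*\vDash_{HMS}\varphi\}$, where: - $w^*\vDash p$ iff $w^*\in v^*(p)$; - $w^*\vDash\neg\varphi$ iff $w^*\in\neg\|\varphi\|:=\{u^*\in W_\Phi\mid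 At(\varphi)\subseteq\Phi\subseteq\mathcal{P},\ u^*\notin\|\varphi\|\}$; - $w^*\vDash\varphi\wedge\psi$ iff $w^*\in\|\varphi\|\cap\|\psi\|$; - $w^*\vDash A_i\varphi$ iff $w^*\in e_{A_i}(\|\varphi\|):=\{u^*\mid W_{At(\varphi)}\le\alpha^*_i(u^*)\}$; - $w^*\vDash I_i\varphi$ iff $w^*\in e_{I_i}(\|\varphi\|):=\{u^*\mid\Lambda^*_i(u^*)\subseteq\|\varphi\|\}$.
   Formalization: For Φ ≠ 𝒫, $\Lambda^*_i([w]_\Phi)$ contains $[v]_\Phi$ iff $w'\sim_i v'$ for some $w'\approx_\Phi w$ and $v'\approx_\Phi v$, so it is taken over all representatives of $[w]_\Phi$ rather than being $m^{\mathcal{P}}_\Phi$ applied to $\Lambda^*_i([w]_{\mathcal{P}})$ for one w. The statement above fails without it. -}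

module Defs where

open import Level using (0ℓ; Lift)
open import Data.Unit using (⊤)
open import Data.Nat using (ℕ)
open import Data.Fin using (Fin)
open import Data.Product using (Σ; ∃; ∃-syntax; _×_; _,_)
open import Data.Sum using (_⊎_)
open import Relation.Nullary using (¬_)
open import Relation.Binary.PropositionalEquality using (_≡_)
open import Relation.Binary using (Rel; IsEquivalence)
open import Relation.Unary using (Pred; _⊆_; _∩_; _≐_; _∈_)
open import Function.Bundles using (_⇔_)

-- Atomic propositions 𝒫 : a countable set, represented by ℕ.
-- Subsets of 𝒫 are predicates  Pred ℕ 0ℓ  (extensional equality _≐_).
AtomSet : Set₁
AtomSet = Pred ℕ 0ℓ

allAtoms : AtomSet
allAtoms _ = ⊤

data PL : Set where
  atom : ℕ → PL
  ¬ₚ_  : PL → PL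
  _∧ₚ_ : PL → PL → PL

At : PL → AtomSet
At (atom q) p = p ≡ q
At (¬ₚ φ)   p = At φ p
At (φ ∧ₚ ψ) p = At φ p ⊎ At ψ p

data AIL* (g : ℕ) : Set where
  prop  : PL → AIL* g
  A     : Fin g → PL → AIL* g
  -- [≈]_i I_i [≈]_i φ
  ≈I≈   : Fin g → PL → AIL* g

data HMS* (g : ℕ) : Set where
  prop : PL → HMS* g
  A    : Fin g → PL → HMS* g
  I    : Fin g → PL → HMS* g

AtAIL : ∀ {g} → AIL* g → AtomSet
AtAIL (prop φ)  = At φ
AtAIL (A i φ)   = At φ
AtAIL (≈I≈ i φ) = At φ

tPL : PL → PL
tPL (atom p) = atom p
tPL (¬ₚ φ)   = ¬ₚ tPL φ
tPL (φ ∧ₚ ψ) = tPL φ ∧ₚ tPL ψ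

t : ∀ {g} → AIL* g → HMS* g
t (prop φ)  = prop (tPL φ)
t (A i φ)   = A i (tPL φ)
t (≈I≈ i φ) = I i (tPL φ)

record Model (g : ℕ) : Set₁ where
  field
    W       : Set
    w₀      : W
    _∼[_]_  : W → Fin g → W → Set
    ∼-equiv : ∀ i → IsEquivalence (λ w v → w ∼[ i ] v)
    𝒜       : Fin g → W → AtomSet
    𝒜-∼     : ∀ i w v → w ∼[ i ] v → 𝒜 i w ≐ 𝒜 i v
    V       : ℕ → Pred W 0ℓ

module _ {g : ℕ} (M : Model g) where
  open Model M

  _≈[_]_ : W → Fin g → W → Set
  w ≈[ i ] v = (𝒜 i w ≐ 𝒜 i v) × (∀ p → p ∈ 𝒜 i w → (V p w ⇔ V p v))

  satPL : W → PL → Set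
  satPL w (atom p) = V p w
  satPL w (¬ₚ φ)   = ¬ satPL w φ
  satPL w (φ ∧ₚ ψ) = satPL w φ × satPL w ψ

  _⊨AIL_ : W → AIL* g → Set
  w ⊨AIL prop φ  = satPL w φ
  w ⊨AIL A i φ   = At φ ⊆ 𝒜 i w
  w ⊨AIL ≈I≈ i φ = ∀ v → (∃[ u ] ∃[ u′ ] (w ≈[ i ] u × u ∼[ i ] u′ × u′ ≈[ i ] v)) → satPL v φ

  ACond : W → AIL* g → Set
  ACond w (prop φ)  = ⊤
  ACond w (A i ψ)   = At ψ ≐ 𝒜 i w
  ACond w (≈I≈ i ψ) = At ψ ≐ 𝒜 i w

  -- HMS-transform.  An element [w]_Φ of W* is represented by the pair
  -- (Φ , w); two representatives denote the same element iff the tags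
  -- are equal (Φ ≐ Ψ) and w ≈_Φ v.

  _≈⟨_⟩_ : W → AtomSet → W → Set
  w ≈⟨ Φ ⟩ v = ∀ p → p ∈ Φ → (V p w ⇔ V p v)

  -- Λ*_i at the top level W_𝒫:  [v]_𝒫 ∈ Λ*_i([w]_𝒫)
  Λ𝒫 : Fin g → W → W → Set
  Λ𝒫 i w v = ∃[ w′ ] ∃[ v′ ] (w′ ≈⟨ allAtoms ⟩ w × v′ ≈⟨ allAtoms ⟩ v × w′ ∼[ i ] v′)

  -- Λ*_i in general:  [v]_Ψ ∈ Λ*_i([w]_Φ)  iff  [v]_Ψ = m^𝒫_Φ(d*) for some
  -- d* ∈ Λ*_i([w₁]_𝒫) with m^𝒫_Φ([w₁]_𝒫) = [w]_Φ.
  -- For Φ = 𝒫 this coincides with Λ𝒫.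
  Λ* : Fin g → (AtomSet × W) → (AtomSet × W) → Set
  Λ* i (Φ , w) (Ψ , v) =
    (Ψ ≐ Φ) × (∃[ w₁ ] ∃[ v₁ ] (w₁ ≈⟨ Φ ⟩ w × Λ𝒫 i w₁ v₁ × v₁ ≈⟨ Φ ⟩ v))

  -- ‖φ‖ for propositional φ, as membership of [w]_Φ
  ‖_‖ : PL → AtomSet → W → Set
  ‖ atom p ‖ Φ w = p ∈ Φ × (∃[ u ] (V p u × u ≈⟨ Φ ⟩ w))
  ‖ ¬ₚ φ ‖   Φ w = (At φ ⊆ Φ) × ¬ (‖ φ ‖ Φ w)
  ‖ φ ∧ₚ ψ ‖ Φ w = ‖ φ ‖ Φ w × ‖ ψ ‖ Φ w

  -- α*_i([w]_Υ) = W_{𝒜_i(w) ∩ Υ}; W_Ψ ≤ W_Φ iff Ψ ⊆ Φ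
  α* : Fin g → AtomSet → W → AtomSet
  α* i Υ w = 𝒜 i w ∩ Υ

  _,_⊨HMS_ : AtomSet → W → HMS* g → Set₁
  Φ , w ⊨HMS prop φ = Lift _ (‖ φ ‖ Φ w)
  Φ , w ⊨HMS A i φ  = Lift _ (At φ ⊆ α* i Φ w)
  Φ , w ⊨HMS I i φ  = ∀ Ψ v → Λ* i (Φ , w) (Ψ , v) → ‖ φ ‖ Ψ v

-- When every agent's awareness is the same at all worlds, the A-condition
-- makes At φ = 𝒜ᵢ(w) the awareness set everywhere, so ≈ᵢ is just agreement on
-- the atoms of φ.  A successor of [w]_{At φ} under Λ*ᵢ then arises from a
-- ∼ᵢ-step between worlds ≈ᵢ-equivalent to w and to the target, and conversely
-- every ≈ᵢ∼ᵢ≈ᵢ-path induces such a successor.  The remaining cases reduce to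
-- the fact that a propositional formula holds at w iff [w]_Φ ∈ ‖φ‖ whenever
-- its atoms lie in Φ.
module Submission where

open import Defs
open import Data.Fin using (Fin)
open import Data.Product using (_,_; proj₁; ∃-syntax; _×_)
open import Data.Sum using (inj₁; inj₂)
open import Data.Unit using (tt)
open import Level using (lift; lower)
open import Relation.Unary using (_≐_; _⊆_; _∩_)
open import Function using (id)
open import Relation.Binary.PropositionalEquality using (_≡_; refl; cong; cong₂)
open import Function.Bundles using (_⇔_; mk⇔; Equivalence)
open import Function.Properties.Equivalence
  using () renaming (refl to ⇔-refl; sym to ⇔-sym; trans to ⇔-trans)

open Equivalence using (to; from)

tPL-id : ∀ φ → tPL φ ≡ φ
tPL-id (atom p) = refl
tPL-id (¬ₚ φ)   = cong ¬ₚ_ (tPL-id φ)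
tPL-id (φ ∧ₚ ψ) = cong₂ _∧ₚ_ (tPL-id φ) (tPL-id ψ)

⊆⇔⊆∩ : {Φ Ψ : AtomSet} → Φ ⊆ Ψ ⇔ Φ ⊆ Ψ ∩ Φ
⊆⇔⊆∩ {Φ} {Ψ} = mk⇔ ⊆⇒⊆∩ ⊆∩⇒⊆
  where
  ⊆⇒⊆∩ : Φ ⊆ Ψ → Φ ⊆ Ψ ∩ Φ
  ⊆⇒⊆∩ Φ⊆Ψ p∈Φ = Φ⊆Ψ p∈Φ , p∈Φ
  ⊆∩⇒⊆ : Φ ⊆ Ψ ∩ Φ → Φ ⊆ Ψ
  ⊆∩⇒⊆ Φ⊆Ψ∩Φ p∈Φ = proj₁ (Φ⊆Ψ∩Φ p∈Φ)

module _ {g} (M : Model g) where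
  open Model M

  ≈⟨⟩-refl : ∀ {Φ} w → _≈⟨_⟩_ M w Φ w
  ≈⟨⟩-refl w p _ = ⇔-refl

  ≈⟨⟩-sym : ∀ {Φ w v} → _≈⟨_⟩_ M w Φ v → _≈⟨_⟩_ M v Φ w
  ≈⟨⟩-sym w≈v p p∈Φ = ⇔-sym (w≈v p p∈Φ)

  ≈⟨⟩-trans : ∀ {Φ u v w} → _≈⟨_⟩_ M u Φ v → _≈⟨_⟩_ M v Φ w → _≈⟨_⟩_ M u Φ w
  ≈⟨⟩-trans u≈v v≈w p p∈Φ = ⇔-trans (u≈v p p∈Φ) (v≈w p p∈Φ)

  ≈⟨⟩-restrict : ∀ {Φ Ψ w v} → Φ ⊆ Ψ → _≈⟨_⟩_ M w Ψ v → _≈⟨_⟩_ M w Φ v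
  ≈⟨⟩-restrict Φ⊆Ψ w≈v p p∈Φ = w≈v p (Φ⊆Ψ p∈Φ)

  satPL⇔‖‖ : ∀ {Φ} w φ → At φ ⊆ Φ → satPL M w φ ⇔ ‖_‖ M φ Φ w
  satPL⇔‖‖ w (atom p) At⊆Φ =
    mk⇔ (λ Vpw → At⊆Φ refl , w , Vpw , ≈⟨⟩-refl w)
        (λ { (p∈Φ , u , Vpu , u≈w) → to (u≈w p p∈Φ) Vpu })
  satPL⇔‖‖ w (¬ₚ φ) At⊆Φ =
    mk⇔ (λ ¬φ → (λ {p} → At⊆Φ {p}) , λ φ∈ → ¬φ (from IH φ∈))
        (λ { (_ , ∉φ) ⊨φ → ∉φ (to IH ⊨φ) })
    where IH = satPL⇔‖‖ w φ At⊆Φ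
  satPL⇔‖‖ w (φ ∧ₚ ψ) At⊆Φ =
    mk⇔ (λ { (⊨φ , ⊨ψ) → to IHφ ⊨φ , to IHψ ⊨ψ })
        (λ { (φ∈ , ψ∈) → from IHφ φ∈ , from IHψ ψ∈ })
    where
    IHφ = satPL⇔‖‖ w φ (λ p∈ → At⊆Φ (inj₁ p∈))
    IHψ = satPL⇔‖‖ w ψ (λ p∈ → At⊆Φ (inj₂ p∈))

  _≈∼≈[_]_ : W → Fin g → W → Set
  w ≈∼≈[ i ] v = ∃[ u ] ∃[ u′ ] (_≈[_]_ M w i u × u ∼[ i ] u′ × _≈[_]_ M u′ i v)

  ≈∼≈⇒Λ* : ∀ {i Φ w v} → Φ ⊆ 𝒜 i w → w ≈∼≈[ i ] v → Λ* M i (Φ , w) (Φ , v)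
  ≈∼≈⇒Λ* {i} {Φ} {w} Φ⊆𝒜w (u , u′ , (𝒜w≐𝒜u , w≈u) , u∼u′ , (_ , u′≈v)) =
    (id , id) , u , u′ ,
    ≈⟨⟩-sym (≈⟨⟩-restrict Φ⊆𝒜w w≈u) ,
    (u , u′ , ≈⟨⟩-refl u , ≈⟨⟩-refl u′ , u∼u′) ,
    ≈⟨⟩-restrict Φ⊆𝒜u′ u′≈v
    where
    Φ⊆𝒜u′ : Φ ⊆ 𝒜 i u′
    Φ⊆𝒜u′ p∈Φ = proj₁ (𝒜-∼ i u u′ u∼u′) (proj₁ 𝒜w≐𝒜u (Φ⊆𝒜w p∈Φ))

  -- Constant awareness is needed here: Λ*ᵢ only tracks the ∼ᵢ-step up to
  -- agreement on all atoms, which alone says nothing about awareness sets.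
  Λ*⇒≈∼≈ : (∀ i w v → 𝒜 i w ≐ 𝒜 i v)
         → ∀ {i Φ Ψ w v} → 𝒜 i w ⊆ Φ → Λ* M i (Φ , w) (Ψ , v) → w ≈∼≈[ i ] v
  Λ*⇒≈∼≈ 𝒜-const {i} {Φ} {w = w} {v}
    𝒜w⊆Φ (_ , w₁ , v₁ , w₁≈w , (w′ , v′ , w′≈w₁ , v′≈v₁ , w′∼v′) , v₁≈v) =
    w′ , v′ ,
    (𝒜-const i w w′ , ≈⟨⟩-restrict 𝒜w⊆Φ w≈w′) , w′∼v′ ,
    (𝒜-const i v′ v , ≈⟨⟩-restrict 𝒜v′⊆Φ v′≈v)
    where
    w≈w′ : _≈⟨_⟩_ M w Φ w′
    w≈w′ = ≈⟨⟩-trans (≈⟨⟩-sym w₁≈w) (≈⟨⟩-sym (≈⟨⟩-restrict (λ _ → tt) w′≈w₁))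
    𝒜v′⊆Φ : 𝒜 i v′ ⊆ Φ
    𝒜v′⊆Φ p∈ = 𝒜w⊆Φ (proj₁ (𝒜-const i v′ w) p∈)
    v′≈v : _≈⟨_⟩_ M v′ Φ v
    v′≈v = ≈⟨⟩-trans (≈⟨⟩-restrict (λ _ → tt) v′≈v₁) v₁≈v

theorem1 : ∀ {g} (M : Model g)
           → (∀ (i : Fin g) w v → Model.𝒜 M i w ≐ Model.𝒜 M i v)
           → (w : Model.W M) (φ : AIL* g)
           → ACond M w φ
           → (_⊨AIL_ M w φ ⇔ _,_⊨HMS_ M (AtAIL φ) w (t φ))
theorem1 M _ w (prop φ) _ rewrite tPL-id φ =
  mk⇔ (λ ⊨φ → lift (to (satPL⇔‖‖ M w φ id) ⊨φ))
      (λ φ∈ → from (satPL⇔‖‖ M w φ id) (lower φ∈))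
theorem1 M _ w (A i φ) _ rewrite tPL-id φ =
  mk⇔ (λ At⊆𝒜 → lift (λ {p} → to ⊆⇔⊆∩ (λ {q} → At⊆𝒜 {q}) {p}))
      (λ At⊆α {p} → from ⊆⇔⊆∩ (λ {q} → lower At⊆α {q}) {p})
theorem1 M 𝒜-const w (≈I≈ i φ) (At⊆𝒜 , 𝒜⊆At) rewrite tPL-id φ = mk⇔ toHMS fromHMS
  where
  toHMS : _⊨AIL_ M w (≈I≈ i φ) → _,_⊨HMS_ M (At φ) w (I i φ)
  toHMS ⊨≈I≈ Ψ v Λwv@((_ , At⊆Ψ) , _) =
    to (satPL⇔‖‖ M v φ At⊆Ψ) (⊨≈I≈ v (Λ*⇒≈∼≈ M 𝒜-const 𝒜⊆At Λwv))
  fromHMS : _,_⊨HMS_ M (At φ) w (I i φ) → _⊨AIL_ M w (≈I≈ i φ)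
  fromHMS ⊨I v w⇝v =
    from (satPL⇔‖‖ M v φ id) (⊨I (At φ) v (≈∼≈⇒Λ* M At⊆𝒜 w⇝v))
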